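{- Let $k \ge 1$. Then $i\mathsf{RCA}_0^\omega$ proves both reduction prenex formulas $S^{\mathsf{LG}_k}_{\mathsf{LPO}}$ and $S^{\mathsf{LPO}}_{\mathsf{LG}_k}$, i.e. both \[\forall p\, \exists G\, \forall y\, \exists v\, (\mathsf{LG}_k(G)=y \to \mathsf{LPO}(p)=v)\] (with $p$ ranging over functions $\mathbb N\to\mathbb N$ and $G$ over graphs) and \[\forall G\, \exists p\, \forall y\, \exists v\, (\mathsf{LPO}(p)=y \to \mathsf{LG}_k(G)=v).\]
   Context: $i\mathsf{RCA}_0^\omega$ is Kohlenbach's higher-order base system $\mathsf{RCA}_0^\omega$ for reverse mathematics with the logic restricted to intuitionistic logic. Graphs have vertex set $\mathbb N$: fix a primitive recursive bijection $\pi$ from $\mathbb N$ onto $\{(a,b): a<b\}$; a function $e:\mathbb N\to\mathbb N$ codes the graph $G$ in which $\pi(n)$ is an edge iff $e(n)\neq 0$. For $m\in\mathbb N$, $G_m$ is the finite subgraph with vertices $\{0,\dots,m\}$ and the edges of $G$ among them; a $k$-coloring of $G_m$ is a map $f$ from $\{0,\dots,m\}$ to $\{0,\dots,k-1\}$ with $f(a)\ne f(b)$ whenever $(a,b)$ is an edge. The predicate $\mathsf{LG}_k(G)=n$ means: if $n=0$ then every $G_m$ has a $k$-coloring, and if $n>0$ then $G_n$ has no $k$-coloring while every $G_t$ with $t<n$ has one. The predicate $\mathsf{LPO}(p)=n$ (for $p:\mathbb N\to\mathbb N$) means: if $n=0$ then $p(j)>0$ for all $j$, and if $n>0$ then $p(n-1)=0$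 and $p(t)>0$ for all $t<n-1$. For total problems $\mathsf P:\forall x\exists y\,P(x,y)$ and $\mathsf Q:\forall u\exists v\,Q(u,v)$, the reduction prenex formula is $S^{\mathsf P}_{\mathsf Q}:\ \forall u\exists x\forall y\exists v\,(P(x,y)\to Q(u,v))$. -}

module Defs where

open import Data.Nat using (ℕ; zero; suc; _+_; _*_; _∸_; _<_; _≤_)
open import Data.Nat.DivMod using (_/_)
open import Data.Fin using (Fin; toℕ)
open import Data.Product using (_×_)
open import Relation.Binary.PropositionalEquality using (_≡_; _≢_)
open import Relation.Nullary using (¬_)

Graph : Set
Graph = ℕ → ℕ

-- The primitive recursive bijection π : ℕ → {(a,b) : a < b} is fixed as the
-- inverse of the enumeration  (a , b) ↦ b * (b ∸ 1) / 2 + a   (a < b),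
-- i.e. pairs are listed as (0,1),(0,2),(1,2),(0,3),(1,3),(2,3),...
code : ℕ → ℕ → ℕ
code a b = (b * (b ∸ 1)) / 2 + a

Edge : Graph → ℕ → ℕ → Set
Edge e a b = a < b × e (code a b) ≢ 0

Colorable : ℕ → Graph → ℕ → Set
Colorable k e m = Data.Product.Σ (Fin (suc m) → Fin k) (λ f → ∀ (a b : Fin (suc m)) → Edge e (toℕ a) (toℕ b) → f a ≢ f b)

LG : ℕ → Graph → ℕ → Set
LG k e zero = ∀ m → Colorable k e m
LG k e (suc n') = ¬ Colorable k e (suc n') × (∀ t → t < suc n' → Colorable k e t)

LPO : (ℕ → ℕ) → ℕ → Set
LPO p zero = ∀ j → 0 < p j
LPO p (suc n') = p n' ≡ 0 × (∀ t → t < n' → 0 < p t)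

-- LPO reduces to LG_k: from p build the graph in which a pair is an edge as
-- soon as p has a zero at an index at most its code.  A zero at j makes the
-- vertices j, …, j+k a (k+1)-clique, so G_(j+k) is not k-colourable; if p has
-- no zero up to the largest code of a pair of vertices ≤ n, then G_n has no
-- edges at all.  Hence LG_k(G) = 0 forces LPO(p) = 0, and LG_k(G) = n+1 lets
-- us find the first zero of p by a bounded search.
--
-- LG_k reduces to LPO: colourability of the finite graph G_m is decidable, so
-- p(m) := [G_m is k-colourable] is a sequence with LPO(p) = LG_k(G) + 1, or 0
-- when both vanish; the value LPO(p) = 1 cannot occur since G_0 is colourable.

module Submission where

open import Defs
open import Data.Nat using (ℕ; _≤_)
open import Data.Product using (_×_; ∃)
open import Data.Nat using (zero; suc; _+_; _*_; _∸_; _<_; _≟_; _<?_; z≤n; s≤s)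
open import Data.Nat.Properties
open import Data.Nat.DivMod using (m/n≤m)
open import Data.Fin as Fin using (Fin; toℕ; fromℕ<; cast; _↑ʳ_)
open import Data.Fin.Properties
  using (pigeonhole; any?; all?; toℕ-cast; toℕ-↑ʳ; toℕ≤pred[n])
  renaming (_≟_ to _≟ᶠ_)
open import Data.Vec.Functional using (_∷_; head; tail)
open import Data.Product using (_,_)
open import Data.Sum using (_⊎_; inj₁; inj₂)
open import Data.Empty using (⊥-elim)
open import Function using (_∘_)
open import Relation.Nullary using (¬_; Dec; yes; no)
open import Relation.Nullary.Decidable using (_×-dec_; _→-dec_; ¬?)
open import Relation.Unary using (Pred; Decidable)
open import Relation.Binary.PropositionalEquality using (_≡_; _≢_; refl; sym; trans)

_≤ₛ_ : {U X : Set} → (U → ℕ → Set) → (X → ℕ → Set) → Set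
_≤ₛ_ {U} {X} Q P = ∀ (u : U) → ∃ λ (x : X) → ∀ y → ∃ λ v → (P x y → Q u v)

indicator : {A : Set} → Dec A → ℕ
indicator (yes _) = 1
indicator (no _)  = 0

indicator≢0⇒ : {A : Set} (d : Dec A) → indicator d ≢ 0 → A
indicator≢0⇒ (yes a) _    = a
indicator≢0⇒ (no _)  0≢0 = ⊥-elim (0≢0 refl)

⇒indicator≢0 : {A : Set} (d : Dec A) → A → indicator d ≢ 0
⇒indicator≢0 (yes _) _ ()
⇒indicator≢0 (no ¬a) a = ⊥-elim (¬a a)

module _ {ℓ} {P : Pred ℕ ℓ} (P? : Decidable P) where

  leastUpTo? : ∀ c → (∀ t → t < c → ¬ P t) ⊎ ∃ λ j → P j × (∀ t → t < j → ¬ P t)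
  leastUpTo? zero = inj₁ λ _ ()
  leastUpTo? (suc c) with leastUpTo? c
  ... | inj₂ least = inj₂ least
  ... | inj₁ none with P? c
  ...   | yes Pc = inj₂ (c , Pc , none)
  ...   | no ¬Pc = inj₁ λ t t<1+c → noneUpTo t (m<1+n⇒m<n∨m≡n t<1+c)
    where
    noneUpTo : ∀ t → t < c ⊎ t ≡ c → ¬ P t
    noneUpTo t (inj₁ t<c) = none t t<c
    noneUpTo t (inj₂ refl) = ¬Pc

cons-≗ : ∀ {a} {A : Set a} {n} (x : A) {f g : Fin n → A} →
         (∀ i → f i ≡ g i) → ∀ i → (x ∷ f) i ≡ (x ∷ g) i
cons-≗ x f≗g Fin.zero    = refl
cons-≗ x f≗g (Fin.suc i) = f≗g i

anyFunction? : ∀ {ℓ n k} {Q : Pred (Fin n → Fin k) ℓ} →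
               (∀ {f g} → (∀ i → f i ≡ g i) → Q f → Q g) → Decidable Q → Dec (∃ Q)
anyFunction? {n = zero} resp Q? with Q? (λ ())
... | yes q = yes (_ , q)
... | no ¬q = no λ (f , q) → ¬q (resp (λ ()) q)
anyFunction? {n = suc n} resp Q?
  with any? (λ x → anyFunction? (resp ∘ cons-≗ x) (Q? ∘ (x ∷_)))
... | yes (x , g , q) = yes (x ∷ g , q)
... | no ¬∃          = no λ (f , q) →
  ¬∃ (head f , tail f , resp (λ { Fin.zero → refl ; (Fin.suc i) → refl }) q)

code-bound : ∀ {a b m} → a ≤ m → b ≤ m → code a b ≤ m * m + m
code-bound {b = b} a≤m b≤m =
  +-mono-≤ (≤-trans (m/n≤m (b * (b ∸ 1)) 2) (*-mono-≤ b≤m (≤-trans (m∸n≤m b 1) b≤m))) a≤m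

≤code : ∀ a b → a ≤ code a b
≤code a b = m≤n+m a _

edge? : ∀ e a b → Dec (Edge e a b)
edge? e a b = a <? b ×-dec ¬? (e (code a b) ≟ 0)

colorable? : ∀ k e m → Dec (Colorable k e m)
colorable? k e m = anyFunction? respects λ f →
  all? λ a → all? λ b → edge? e (toℕ a) (toℕ b) →-dec ¬? (f a ≟ᶠ f b)
  where
  respects : ∀ {f g : Fin (suc m) → Fin k} → (∀ i → f i ≡ g i) →
             (∀ a b → Edge e (toℕ a) (toℕ b) → f a ≢ f b) →
             (∀ a b → Edge e (toℕ a) (toℕ b) → g a ≢ g b)
  respects f≗g proper a b edge ga≡gb = proper a b edge (trans (f≗g a) (trans ga≡gb (sym (f≗g b))))

edgeless⇒colorable : ∀ {k e m} → 0 < k → (∀ {a b} → a ≤ m → b ≤ m → ¬ Edge e a b) →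
                     Colorable k e m
edgeless⇒colorable 0<k edgeless =
  (λ _ → fromℕ< 0<k) , λ a b edge _ → edgeless (toℕ≤pred[n] a) (toℕ≤pred[n] b) edge

clique⇒¬colorable : ∀ {k e m} (c : Fin (suc k) → Fin (suc m)) →
                    (∀ {i i'} → i Fin.< i' → Edge e (toℕ (c i)) (toℕ (c i'))) →
                    ¬ Colorable k e m
clique⇒¬colorable c clique (f , proper) with pigeonhole (n<1+n _) (f ∘ c)
... | i , i' , i<i' , same = proper (c i) (c i') (clique i<i') same

shift : ∀ j {k} → Fin (suc k) → Fin (suc (j + k))
shift j {k} i = cast (+-suc j k) (j ↑ʳ i)

toℕ-shift : ∀ j {k} (i : Fin (suc k)) → toℕ (shift j i) ≡ j + toℕ i
toℕ-shift j i = trans (toℕ-cast _ (j ↑ʳ i)) (toℕ-↑ʳ j i)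

zeroGraph : (ℕ → ℕ) → Graph
zeroGraph p c = indicator (anyUpTo? (λ t → p t ≟ 0) (suc c))

zeroGraph-edge : ∀ p {j a b} → p j ≡ 0 → j ≤ a → a < b → Edge (zeroGraph p) a b
zeroGraph-edge p {j} {a} {b} pj≡0 j≤a a<b =
  a<b , ⇒indicator≢0 (anyUpTo? _ _) (j , s≤s (≤-trans j≤a (≤code a b)) , pj≡0)

zeroGraph-edgeless : ∀ p {m a b} → (∀ t → t < suc (m * m + m) → p t ≢ 0) →
                     a ≤ m → b ≤ m → ¬ Edge (zeroGraph p) a b
zeroGraph-edgeless p none a≤m b≤m (_ , edge)
  with indicator≢0⇒ (anyUpTo? _ _) edge
... | t , s≤s t≤code , pt≡0 = none t (s≤s (≤-trans t≤code (code-bound a≤m b≤m))) pt≡0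

zeroGraph-¬colorable : ∀ p k {j} → p j ≡ 0 → ¬ Colorable k (zeroGraph p) (j + k)
zeroGraph-¬colorable p k {j} pj≡0 = clique⇒¬colorable {e = zeroGraph p} (shift j) edge
  where
  edge : ∀ {i i'} → i Fin.< i' → Edge (zeroGraph p) (toℕ (shift j i)) (toℕ (shift j i'))
  edge {i} {i'} i<i' rewrite toℕ-shift j i | toℕ-shift j i' =
    zeroGraph-edge p pj≡0 (m≤m+n j (toℕ i)) (+-monoʳ-< j i<i')

LPO≤ₛLG : ∀ k → 0 < k → LPO ≤ₛ LG k
LPO≤ₛLG k 0<k p = zeroGraph p , solve
  where
  solve : ∀ y → ∃ λ v → (LG k (zeroGraph p) y → LPO p v)
  solve zero = 0 , λ colorable j → n≢0⇒n>0 λ pj≡0 →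
    zeroGraph-¬colorable p k pj≡0 (colorable (j + k))
  solve (suc n) with leastUpTo? (λ t → p t ≟ 0) (suc (suc n * suc n + suc n))
  ... | inj₂ (j , pj≡0 , before) = suc j , λ _ → pj≡0 , λ t t<j → n≢0⇒n>0 (before t t<j)
  ... | inj₁ none = 0 , λ (¬colorable , _) →
    ⊥-elim (¬colorable (edgeless⇒colorable {e = zeroGraph p} 0<k (zeroGraph-edgeless p none)))

colorabilitySequence : ℕ → Graph → ℕ → ℕ
colorabilitySequence k e m = indicator (colorable? k e m)

LG≤ₛLPO : ∀ k → 0 < k → LG k ≤ₛ LPO
LG≤ₛLPO k 0<k e = colorabilitySequence k e , solve
  where
  colorable : ∀ {m} → 0 < colorabilitySequence k e m → Colorable k e m
  colorable = indicator≢0⇒ (colorable? k e _) ∘ n>0⇒n≢0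

  uncolorable : ∀ {m} → colorabilitySequence k e m ≡ 0 → ¬ Colorable k e m
  uncolorable s≡0 col = ⇒indicator≢0 (colorable? k e _) col s≡0

  solve : ∀ y → ∃ λ v → (LPO (colorabilitySequence k e) y → LG k e v)
  solve zero = 0 , λ allColorable m → colorable (allColorable m)
  solve (suc zero) = 0 , λ (s₀≡0 , _) →
    ⊥-elim (uncolorable s₀≡0 (edgeless⇒colorable {e = e} 0<k λ { z≤n z≤n (() , _) }))
  solve (suc (suc n)) = suc n , λ (s≡0 , before) →
    uncolorable s≡0 , λ t t<1+n → colorable (before t t<1+n)

lemma4 : ∀ (k : ℕ) → 1 ≤ k →
    (∀ (p : ℕ → ℕ) → ∃ λ (G : Graph) → ∀ (y : ℕ) → ∃ λ (v : ℕ) → (LG k G y → LPO p v))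
    × (∀ (G : Graph) → ∃ λ (p : ℕ → ℕ) → ∀ (y : ℕ) → ∃ λ (v : ℕ) → (LPO p y → LG k G v))
lemma4 k 1≤k = LPO≤ₛLG k 1≤k , LG≤ₛLPO k 1≤k
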